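{- For each integer $m\ge 1$ let $C_m=\det C^{(m)}$, where $C^{(m)}$ is the $m\times m$ matrix with entries $C^{(m)}_{ij}=1$ if $-2\le j-i\le 1$ and $0$ otherwise. Let $a\in\mathbb{R}$ and let $n\ge 4$ be an integer. Let $P^{(n)}$ be the $n\times n$ matrix whose first row has $P^{(n)}_{11}=P^{(n)}_{12}=1$, $P^{(n)}_{1n}=a$ and all other entries $0$, and whose rows $i=2,\dots,n$ have $P^{(n)}_{ij}=1$ if $-2\le j-i\le 1$ and $0$ otherwise. Let $P_n=\det P^{(n)}$. Then $$P_n = C_{n-1}\bigl(1+a(-1)^{n+1}\bigr) - C_{n-2} + C_{n-3}.$$ -}

module Defs where

open import Algebra.Bundles using (CommutativeRing)
open import Data.Nat as ℕ using (ℕ; zero; suc; _∸_; _≡ᵇ_; _≤ᵇ_)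
open import Data.Fin using (Fin; toℕ; punchIn)
import Data.Fin as F
open import Data.Bool using (Bool; true; false; if_then_else_; _∧_; _∨_)

module Determinant {c ℓ} (R : CommutativeRing c ℓ) where
  open CommutativeRing R

  Matrix : ℕ → Set c
  Matrix n = Fin n → Fin n → Carrier

  ∑ : ∀ n → (Fin n → Carrier) → Carrier
  ∑ zero    f = 0#
  ∑ (suc n) f = f F.zero + ∑ n (λ j → f (F.suc j))

  sign : ℕ → Carrier
  sign zero    = 1#
  sign (suc k) = - sign k

  minor : ∀ {n} → Fin (suc n) → Matrix (suc n) → Matrix n
  minor j M i k = M (F.suc i) (punchIn j k)

  det : ∀ n → Matrix n → Carrier
  det zero    M = 1#
  det (suc n) M = ∑ (suc n) (λ j → sign (toℕ j) * (M F.zero j * det n (minor j M)))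

  -- band condition  -2 ≤ j - i ≤ 1  (0-indexed i, j; same as 1-indexed)
  band : ℕ → ℕ → Bool
  band i j = (i ≤ᵇ j ℕ.+ 2) ∧ (j ≤ᵇ i ℕ.+ 1)

  indicator : Bool → Carrier
  indicator true  = 1#
  indicator false = 0#

  Cmat : ∀ m → Matrix m
  Cmat m i j = indicator (band (toℕ i) (toℕ j))

  Cdet : ℕ → Carrier
  Cdet m = det m (Cmat m)

  -- the matrix P^(n) with parameter a (rows/columns 0-indexed:
  -- first row has 1 in columns 0,1 and a in column n-1)
  Pmat : ∀ n → Carrier → Matrix n
  Pmat n a F.zero    j = if (toℕ j ≡ᵇ 0) ∨ (toℕ j ≡ᵇ 1) then 1#
                         else (if toℕ j ≡ᵇ (n ∸ 1) then a else 0#)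
  Pmat n a (F.suc i) j = indicator (band (toℕ (F.suc i)) (toℕ j))

  Pdet : ℕ → Carrier → Carrier
  Pdet n a = det n (Pmat n a)

module Submission where

-- Determinants are Laplace expansions along the first row (Defs), so the proof
-- repeatedly expands along first rows that have only two or three nonzero entries.
--  * Generic facts: det respects entrywise equality, vanishes when the first column
--    is zero, and reduces to two or three cofactors for first rows of the shapes
--    (1,1,0,…,0), (1,1,1,0,…,0) and (1,1,0,…,0,x).
--  * Band determinants: deleting column 1 of C^(m+2) leaves C^(m+1) with a modified
--    first column.  Expanding the family G_d of such matrices yields the recurrence
--    C_{m+3} = C_{m+2} - (C_{m+1} - C_m).
--  * The cofactor of the corner entry a of P^(n) is the transposed band matrix H
--    (ones for -1 ≤ j - i ≤ 2).  Expanding H together with two variants K, L of it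
--    proves det H_{m+2} = C_{m+2}, det K_{m+2} = C_{m+1}, det L_{m+2} = C_m at once.
--  * Expanding P^(n) along its first row gives
--    P_n = C_{n-1} - (C_{n-2} - C_{n-3}) + (-1)^{n-1} a C_{n-1}, which rearranges
--    into the claimed formula.

open import Defs
open import Algebra.Bundles using (CommutativeRing)
open import Data.Nat using (ℕ; _≤_; _∸_; zero; suc; _≤ᵇ_; _<ᵇ_; _≡ᵇ_; s≤s; z≤n)
import Data.Nat as ℕ
import Data.Nat.Properties as ℕP
open import Data.Fin using (Fin; toℕ; punchIn; fromℕ; inject₁)
import Data.Fin as F
import Data.Fin.Properties as FP
open import Data.Bool using (Bool; false; true; _∧_; if_then_else_)
import Data.Bool.Properties as BP
open import Data.Product using (_×_; _,_; proj₁)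
open import Relation.Binary.PropositionalEquality as ≡ using (_≡_)

≤ᵇ-suc : ∀ a b → (suc a ≤ᵇ suc b) ≡ (a ≤ᵇ b)
≤ᵇ-suc zero    b = ≡.refl
≤ᵇ-suc (suc a) b = ≡.refl

≡ᵇ-refl : ∀ k → (k ≡ᵇ k) ≡ true
≡ᵇ-refl zero    = ≡.refl
≡ᵇ-refl (suc k) = ≡ᵇ-refl k

inject₁-≢ᵇ-bound : ∀ k (j : Fin (suc k)) → (toℕ (inject₁ j) ≡ᵇ suc k) ≡ false
inject₁-≢ᵇ-bound k       F.zero    = ≡.refl
inject₁-≢ᵇ-bound (suc k) (F.suc j) = inject₁-≢ᵇ-bound k j

toℕ-punchIn-fromℕ : ∀ n (k : Fin n) → toℕ (punchIn (fromℕ n) k) ≡ toℕ k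
toℕ-punchIn-fromℕ (suc n) F.zero    = ≡.refl
toℕ-punchIn-fromℕ (suc n) (F.suc k) = ≡.cong suc (toℕ-punchIn-fromℕ n k)

module BandDeterminants {c ℓ} (R : CommutativeRing c ℓ) where
  open CommutativeRing R
  open Determinant R
  open import Algebra.Properties.Ring ring using (-1*x≈-x; -‿involutive; -0#≈0#; -‿+-comm)
  open import Relation.Binary.Reasoning.Setoid setoid

  x-0≈x : ∀ {x y} → y ≈ 0# → x - y ≈ x
  x-0≈x {x} y≈0 = trans (+-congˡ (trans (-‿cong y≈0) -0#≈0#)) (+-identityʳ x)

  sub-sub : ∀ x y z → (x - y) + z ≈ x - (y - z)
  sub-sub x y z = begin
    (x - y) + z         ≈⟨ +-assoc x (- y) z ⟩
    x + (- y + z)       ≈⟨ +-congˡ (+-congˡ (sym (-‿involutive z))) ⟩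
    x + (- y + - (- z)) ≈⟨ +-congˡ (-‿+-comm y (- z)) ⟩
    x - (y - z)         ∎

  sign-+2 : ∀ k → sign (suc (suc k)) ≈ sign k
  sign-+2 k = -‿involutive (sign k)

  rearrange : ∀ a X Y Z s → (X - (Y - Z)) + s * (a * X) ≈ (X * (1# + a * s) - Y) + Z
  rearrange a X Y Z s = begin
    (X - (Y - Z)) + W ≈⟨ +-congʳ (sym (sub-sub X Y Z)) ⟩
    ((X - Y) + Z) + W ≈⟨ +-assoc (X - Y) Z W ⟩
    (X - Y) + (Z + W) ≈⟨ +-congˡ (+-comm Z W) ⟩
    (X - Y) + (W + Z) ≈⟨ sym (+-assoc (X - Y) W Z) ⟩
    ((X - Y) + W) + Z ≈⟨ +-congʳ (+-assoc X (- Y) W) ⟩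
    (X + (- Y + W)) + Z ≈⟨ +-congʳ (+-congˡ (+-comm (- Y) W)) ⟩
    (X + (W - Y)) + Z ≈⟨ +-congʳ (sym (+-assoc X W (- Y))) ⟩
    ((X + W) - Y) + Z ≈⟨ +-congʳ (+-congʳ (sym X[1+as]≈X+W)) ⟩
    (X * (1# + a * s) - Y) + Z ∎
    where
    W : Carrier
    W = s * (a * X)
    X[1+as]≈X+W : X * (1# + a * s) ≈ X + W
    X[1+as]≈X+W = begin
      X * (1# + a * s)      ≈⟨ distribˡ X 1# (a * s) ⟩
      X * 1# + X * (a * s)  ≈⟨ +-cong (*-identityʳ X) (*-comm X (a * s)) ⟩
      X + (a * s) * X       ≈⟨ +-congˡ (*-congʳ (*-comm a s)) ⟩
      X + (s * a) * X       ≈⟨ +-congˡ (*-assoc s a X) ⟩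
      X + W                 ∎

  cofactor-zero : ∀ s x d → x ≈ 0# → s * (x * d) ≈ 0#
  cofactor-zero s x d x≈0 = trans (*-congˡ (trans (*-congʳ x≈0) (zeroˡ d))) (zeroʳ s)

  cofactor-col₀ : ∀ x d → x ≈ 1# → sign 0 * (x * d) ≈ d
  cofactor-col₀ x d x≈1 = trans (*-identityˡ _) (trans (*-congʳ x≈1) (*-identityˡ d))

  cofactor-col₁ : ∀ x d → x ≈ 1# → sign 1 * (x * d) ≈ - d
  cofactor-col₁ x d x≈1 = trans (-1*x≈-x _) (-‿cong (trans (*-congʳ x≈1) (*-identityˡ d)))

  cofactor-col₂ : ∀ x d → x ≈ 1# → sign 2 * (x * d) ≈ d
  cofactor-col₂ x d x≈1 = trans (*-congʳ (sign-+2 0)) (cofactor-col₀ x d x≈1)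

  ∑-cong : ∀ n {f g : Fin n → Carrier} → (∀ j → f j ≈ g j) → ∑ n f ≈ ∑ n g
  ∑-cong zero    f≈g = refl
  ∑-cong (suc n) f≈g = +-cong (f≈g F.zero) (∑-cong n (λ j → f≈g (F.suc j)))

  ∑-zero : ∀ n {f : Fin n → Carrier} → (∀ j → f j ≈ 0#) → ∑ n f ≈ 0#
  ∑-zero zero    f≈0 = refl
  ∑-zero (suc n) f≈0 = trans (+-cong (f≈0 F.zero) (∑-zero n (λ j → f≈0 (F.suc j)))) (+-identityˡ 0#)

  ∑-last : ∀ p (f : Fin (suc p) → Carrier) → (∀ j → f (inject₁ j) ≈ 0#) → ∑ (suc p) f ≈ f (fromℕ p)
  ∑-last zero    f f≈0 = +-identityʳ _
  ∑-last (suc p) f f≈0 =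
    trans (+-cong (f≈0 F.zero) (∑-last p (λ j → f (F.suc j)) (λ j → f≈0 (F.suc j)))) (+-identityˡ _)

  _≋_ : ∀ {n} → Matrix n → Matrix n → Set ℓ
  M ≋ N = ∀ i j → M i j ≈ N i j

  det-cong : ∀ n {M N : Matrix n} → M ≋ N → det n M ≈ det n N
  det-cong zero    M≋N = refl
  det-cong (suc n) M≋N = ∑-cong (suc n) λ j →
    *-congˡ {sign (toℕ j)} (*-cong (M≋N F.zero j) (det-cong n (λ i k → M≋N (F.suc i) (punchIn j k))))

  det-1×1 : ∀ (M : Matrix 1) → det 1 M ≈ M F.zero F.zero
  det-1×1 M = trans (+-identityʳ _) (trans (*-identityˡ _) (*-identityʳ _))

  det-zero-column : ∀ m (M : Matrix (suc m)) → (∀ i → M i F.zero ≈ 0#) → det (suc m) M ≈ 0#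
  det-zero-column zero    M col≈0 = trans (+-identityʳ _) (cofactor-zero 1# _ _ (col≈0 F.zero))
  det-zero-column (suc m) M col≈0 =
    trans (+-cong (cofactor-zero 1# _ _ (col≈0 F.zero)) (∑-zero (suc m) later)) (+-identityˡ 0#)
    where
    -- every further minor still contains the (shortened) zero first column
    later : ∀ j → sign (toℕ (F.suc j)) * (M F.zero (F.suc j) * det (suc m) (minor (F.suc j) M)) ≈ 0#
    later j = trans (*-congˡ (trans (*-congˡ minor≈0) (zeroʳ _))) (zeroʳ _)
      where
      minor≈0 : det (suc m) (minor (F.suc j) M) ≈ 0#
      minor≈0 = det-zero-column m (minor (F.suc j) M) (λ i → col≈0 (F.suc i))

  laplace-11 : ∀ m (M : Matrix (suc (suc m))) →
               M F.zero F.zero ≈ 1# → M F.zero (F.suc F.zero) ≈ 1# →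
               (∀ j → M F.zero (F.suc (F.suc j)) ≈ 0#) →
               det (suc (suc m)) M ≈ det (suc m) (minor F.zero M) - det (suc m) (minor (F.suc F.zero) M)
  laplace-11 m M e₀ e₁ rest≈0 =
    +-cong (cofactor-col₀ _ _ e₀)
           (trans (+-cong (cofactor-col₁ _ _ e₁) (∑-zero m (λ j → cofactor-zero _ _ _ (rest≈0 j))))
                  (+-identityʳ _))

  laplace-111 : ∀ m (M : Matrix (suc (suc (suc m)))) →
                M F.zero F.zero ≈ 1# → M F.zero (F.suc F.zero) ≈ 1# → M F.zero (F.suc (F.suc F.zero)) ≈ 1# →
                (∀ j → M F.zero (F.suc (F.suc (F.suc j))) ≈ 0#) →
                det (suc (suc (suc m))) M ≈
                  (det (suc (suc m)) (minor F.zero M) - det (suc (suc m)) (minor (F.suc F.zero) M))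
                  + det (suc (suc m)) (minor (F.suc (F.suc F.zero)) M)
  laplace-111 m M e₀ e₁ e₂ rest≈0 =
    trans (+-cong (cofactor-col₀ _ _ e₀)
                  (+-cong (cofactor-col₁ _ _ e₁)
                          (trans (+-cong (cofactor-col₂ _ _ e₂)
                                         (∑-zero m (λ j → cofactor-zero _ _ _ (rest≈0 j))))
                                 (+-identityʳ _))))
          (sym (+-assoc _ _ _))

  laplace-11-last : ∀ p (M : Matrix (suc (suc (suc p)))) (x : Carrier) →
                    M F.zero F.zero ≈ 1# → M F.zero (F.suc F.zero) ≈ 1# →
                    (∀ j → M F.zero (F.suc (F.suc (inject₁ j))) ≈ 0#) →
                    M F.zero (F.suc (F.suc (fromℕ p))) ≈ x →
                    det (suc (suc (suc p))) M ≈
                      (det (suc (suc p)) (minor F.zero M) - det (suc (suc p)) (minor (F.suc F.zero) M))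
                      + sign (suc (suc p)) * (x * det (suc (suc p)) (minor (F.suc (F.suc (fromℕ p))) M))
  laplace-11-last p M x e₀ e₁ middle≈0 last≈x =
    trans (+-cong (cofactor-col₀ _ _ e₀)
                  (+-cong (cofactor-col₁ _ _ e₁)
                          (trans (∑-last p f (λ j → cofactor-zero _ _ _ (middle≈0 j))) last-term)))
          (sym (+-assoc _ _ _))
    where
    f : Fin (suc p) → Carrier
    f j = sign (toℕ (F.suc (F.suc j))) * (M F.zero (F.suc (F.suc j)) * det (suc (suc p)) (minor (F.suc (F.suc j)) M))
    last-term : f (fromℕ p) ≈ sign (suc (suc p)) * (x * det (suc (suc p)) (minor (F.suc (F.suc (fromℕ p))) M))
    last-term = *-cong (reflexive (≡.cong (λ t → sign (suc (suc t))) (FP.toℕ-fromℕ p))) (*-congʳ last≈x)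

  band-suc : ∀ i j → band (suc i) (suc j) ≡ band i j
  band-suc i j = ≡.cong₂ _∧_ (≤ᵇ-suc i (j ℕ.+ 2)) (≤ᵇ-suc j (i ℕ.+ 1))

  indicator-cong : ∀ {b b′} → b ≡ b′ → indicator b ≈ indicator b′
  indicator-cong b≡b′ = reflexive (≡.cong indicator b≡b′)

  -- C^(m) with its first column replaced by the indicator of the rows i with d + i ≤ 2.
  -- Deleting column 1 of C^(m+1) gives G 1 m; deleting column 1 of G d gives G (d+1).
  Gmat : ℕ → ∀ m → Matrix m
  Gmat d m i F.zero    = indicator (d ℕ.+ toℕ i ≤ᵇ 2)
  Gmat d m i (F.suc k) = indicator (band (toℕ i) (suc (toℕ k)))

  Gdet : ℕ → ℕ → Carrier
  Gdet d m = det m (Gmat d m)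

  -- Deleting the first row and column of C^(m+1) leaves C^(m).  (The same holds
  -- definitionally for G d and P^(n), whose rows below the first are those of C.)
  minor₀-C : ∀ m → minor F.zero (Cmat (suc m)) ≋ Cmat m
  minor₀-C m i k = indicator-cong (band-suc (toℕ i) (toℕ k))

  minor₁-C : ∀ m → minor (F.suc F.zero) (Cmat (suc (suc m))) ≋ Gmat 1 (suc m)
  minor₁-C m i F.zero    = indicator-cong (BP.∧-identityʳ (toℕ i <ᵇ 2))
  minor₁-C m i (F.suc k) = indicator-cong (band-suc (toℕ i) (suc (toℕ k)))

  C-expand : ∀ m → Cdet (suc (suc m)) ≈ Cdet (suc m) - Gdet 1 (suc m)
  C-expand m = trans (laplace-11 m (Cmat _) refl refl (λ j → refl))
                     (+-cong (det-cong _ (minor₀-C (suc m)))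
                             (-‿cong (det-cong _ (minor₁-C m))))

  G-corner : ∀ {d} m → d ≤ 2 → Gmat d (suc m) F.zero F.zero ≈ 1#
  G-corner m z≤n             = refl
  G-corner m (s≤s z≤n)       = refl
  G-corner m (s≤s (s≤s z≤n)) = refl

  G-expand : ∀ {d} m → d ≤ 2 → Gdet d (suc (suc m)) ≈ Cdet (suc m) - Gdet (suc d) (suc m)
  G-expand {d} m d≤2 =
    trans (laplace-11 m (Gmat d _) (G-corner (suc m) d≤2) refl (λ j → refl))
          (+-cong (det-cong _ (minor₀-C (suc m))) (-‿cong (det-cong _ minor₁-G)))
    where
    minor₁-G : minor (F.suc F.zero) (Gmat d (suc (suc m))) ≋ Gmat (suc d) (suc m)
    minor₁-G i F.zero    = indicator-cong (≡.cong (_≤ᵇ 2) (ℕP.+-suc d (toℕ i)))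
    minor₁-G i (F.suc k) = indicator-cong (band-suc (toℕ i) (suc (toℕ k)))

  G₃-vanishes : ∀ m → Gdet 3 (suc m) ≈ 0#
  G₃-vanishes m = det-zero-column m (Gmat 3 (suc m)) (λ i → refl)

  G₂≈C : ∀ m → Gdet 2 (suc m) ≈ Cdet m
  G₂≈C zero    = det-1×1 (Gmat 2 1)
  G₂≈C (suc m) = trans (G-expand m (s≤s (s≤s z≤n))) (x-0≈x (G₃-vanishes m))

  G₁≈C-C : ∀ m → Gdet 1 (suc (suc m)) ≈ Cdet (suc m) - Cdet m
  G₁≈C-C m = trans (G-expand m (s≤s z≤n)) (+-congˡ (-‿cong (G₂≈C m)))

  C-recurrence : ∀ m → Cdet (suc (suc (suc m))) ≈ Cdet (suc (suc m)) - (Cdet (suc m) - Cdet m)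
  C-recurrence m = trans (C-expand (suc m)) (+-congˡ (-‿cong (G₁≈C-C m)))

  -- First column: indicator of rows i < p; second column: rows i < q; further columns
  -- as in the transposed band matrix with ones for -1 ≤ j - i ≤ 2.
  -- H = Hmat 2 3 is that transposed band matrix itself; K = Hmat 1 3 and L = Hmat 1 2.
  Hmat : ℕ → ℕ → ∀ m → Matrix m
  Hmat p q m i F.zero             = indicator (suc (toℕ i) ≤ᵇ p)
  Hmat p q m i (F.suc F.zero)     = indicator (suc (toℕ i) ≤ᵇ q)
  Hmat p q m i (F.suc (F.suc k))  = indicator (band (suc (toℕ i)) (suc (suc (toℕ k))))

  Hdet : ℕ → ℕ → ℕ → Carrier
  Hdet p q m = det m (Hmat p q m)

  -- Each of the three minors of the first row is again of the form Hmat.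
  H-expand : ∀ p q m → Hdet (suc p) (suc q) (suc (suc (suc m))) ≈
                        (Hdet q 3 (suc (suc m)) - Hdet p 3 (suc (suc m))) + Hdet p q (suc (suc m))
  H-expand p q m = trans (laplace-111 m M refl refl refl (λ j → refl))
                         (+-cong (+-cong (det-cong _ minor₀) (-‿cong (det-cong _ minor₁))) (det-cong _ minor₂))
    where
    M : Matrix (suc (suc (suc m)))
    M = Hmat (suc p) (suc q) (suc (suc (suc m)))
    column-2 : ∀ i → band (suc (suc i)) 2 ≡ (suc i ≤ᵇ 3)
    column-2 i = ≡.trans (BP.∧-identityʳ _) (≤ᵇ-suc (suc i) 3)
    later-columns : ∀ i k → M (F.suc i) (F.suc (F.suc (F.suc k))) ≈ Hmat p q (suc (suc m)) i (F.suc (F.suc k))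
    later-columns i k = indicator-cong (band-suc (suc (toℕ i)) (suc (suc (toℕ k))))
    minor₀ : minor F.zero M ≋ Hmat q 3 (suc (suc m))
    minor₀ i F.zero            = indicator-cong (≤ᵇ-suc (suc (toℕ i)) q)
    minor₀ i (F.suc F.zero)    = indicator-cong (column-2 (toℕ i))
    minor₀ i (F.suc (F.suc k)) = later-columns i k
    minor₁ : minor (F.suc F.zero) M ≋ Hmat p 3 (suc (suc m))
    minor₁ i F.zero            = indicator-cong (≤ᵇ-suc (suc (toℕ i)) p)
    minor₁ i (F.suc F.zero)    = indicator-cong (column-2 (toℕ i))
    minor₁ i (F.suc (F.suc k)) = later-columns i k
    minor₂ : minor (F.suc (F.suc F.zero)) M ≋ Hmat p q (suc (suc m))
    minor₂ i F.zero            = indicator-cong (≤ᵇ-suc (suc (toℕ i)) p)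
    minor₂ i (F.suc F.zero)    = indicator-cong (≤ᵇ-suc (suc (toℕ i)) q)
    minor₂ i (F.suc (F.suc k)) = later-columns i k

  H₀-vanishes : ∀ q m → Hdet 0 q (suc m) ≈ 0#
  H₀-vanishes q m = det-zero-column m (Hmat 0 q (suc m)) (λ i → refl)

  -- For Hmat 1 q the cofactors of columns 1 and 2 keep a zero first column,
  -- so only the cofactor of column 0 survives.
  H₁-expand : ∀ q m → Hdet 1 (suc q) (suc (suc (suc m))) ≈ Hdet q 3 (suc (suc m))
  H₁-expand q m = trans (H-expand 0 q m)
                        (trans (+-cong (x-0≈x (H₀-vanishes 3 (suc m))) (H₀-vanishes q (suc m))) (+-identityʳ _))

  -- K = Hmat 1 3 of size 2 is upper unitriangular (and equals L = Hmat 1 2).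
  K₂≈1 : Hdet 1 3 2 ≈ 1#
  K₂≈1 = trans (laplace-11 0 K refl refl (λ ()))
               (trans (+-cong (det-1×1 (minor F.zero K)) (-‿cong (det-1×1 (minor (F.suc F.zero) K))))
                      (x-0≈x refl))
    where
    K : Matrix 2
    K = Hmat 1 3 2

  -- The transposed band determinants, and those of K and L, are shifted band determinants:
  -- the triple (H, K, L) of size m+2 evolves by H ↦ H - K + L, K ↦ H, L ↦ K,
  -- which C-recurrence matches with (C_{m+2}, C_{m+1}, C_m).
  H≈C : ∀ m → (Hdet 2 3 (suc (suc m)) ≈ Cdet (suc (suc m)))
            × (Hdet 1 3 (suc (suc m)) ≈ Cdet (suc m))
            × (Hdet 1 2 (suc (suc m)) ≈ Cdet m)
  H≈C zero    = refl , trans K₂≈1 (sym (det-1×1 (Cmat 1))) , K₂≈1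
  H≈C (suc m) with H≈C m
  ... | H≈ , K≈ , L≈ = H-step , trans (H₁-expand 2 m) H≈ , trans (H₁-expand 1 m) K≈
    where
    H-step : Hdet 2 3 (suc (suc (suc m))) ≈ Cdet (suc (suc (suc m)))
    H-step = begin
      Hdet 2 3 (suc (suc (suc m)))
        ≈⟨ H-expand 1 2 m ⟩
      (Hdet 2 3 (suc (suc m)) - Hdet 1 3 (suc (suc m))) + Hdet 1 2 (suc (suc m))
        ≈⟨ +-cong (+-cong H≈ (-‿cong K≈)) L≈ ⟩
      (Cdet (suc (suc m)) - Cdet (suc m)) + Cdet m
        ≈⟨ sub-sub _ _ _ ⟩
      Cdet (suc (suc m)) - (Cdet (suc m) - Cdet m)
        ≈⟨ sym (C-recurrence m) ⟩
      Cdet (suc (suc (suc m)))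
        ∎

  -- Row i+1 of P^(n), read in columns 0, …, n-2, is row i of the transposed band matrix.
  Hmat-band : ∀ m (i j : Fin m) → indicator (band (suc (toℕ i)) (toℕ j)) ≈ Hmat 2 3 m i j
  Hmat-band m i F.zero            = indicator-cong (BP.∧-identityʳ (toℕ i <ᵇ 2))
  Hmat-band m i (F.suc F.zero)    = indicator-cong (BP.∧-identityʳ (toℕ i <ᵇ 3))
  Hmat-band m i (F.suc (F.suc k)) = refl

  P-expand : ∀ k a → Pdet (4 ℕ.+ k) a ≈
             (Cdet (3 ℕ.+ k) - Gdet 1 (3 ℕ.+ k)) + sign (3 ℕ.+ k) * (a * Hdet 2 3 (3 ℕ.+ k))
  P-expand k a =
    trans (laplace-11-last (suc k) P a refl refl middle≈0 corner≈a)
          (+-cong (+-cong (det-cong _ (minor₀-C (3 ℕ.+ k))) (-‿cong (det-cong _ (minor₁-C (suc (suc k))))))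
                  (*-congˡ (*-congˡ (det-cong _ corner-minor))))
    where
    P : Matrix (4 ℕ.+ k)
    P = Pmat (4 ℕ.+ k) a
    pick : Bool → Carrier
    pick b = if b then a else 0#
    middle≈0 : ∀ j → P F.zero (F.suc (F.suc (inject₁ j))) ≈ 0#
    middle≈0 j = reflexive (≡.cong pick (inject₁-≢ᵇ-bound k j))
    corner≈a : P F.zero (fromℕ (3 ℕ.+ k)) ≈ a
    corner≈a = reflexive (≡.cong pick (≡.trans (≡.cong (_≡ᵇ suc k) (FP.toℕ-fromℕ (suc k))) (≡ᵇ-refl (suc k))))
    corner-minor : minor (fromℕ (3 ℕ.+ k)) P ≋ Hmat 2 3 (3 ℕ.+ k)
    corner-minor i j =
      trans (indicator-cong (≡.cong (band (suc (toℕ i))) (toℕ-punchIn-fromℕ _ j))) (Hmat-band _ i j)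

lemma6 : ∀ {c ℓ} (R : CommutativeRing c ℓ) (a : CommutativeRing.Carrier R) (n : ℕ) → 4 ≤ n →
           let open CommutativeRing R
               open Determinant R
           in
           Pdet n a ≈ (Cdet (n ∸ 1) * (1# + a * sign (n ℕ.+ 1)) - Cdet (n ∸ 2)) + Cdet (n ∸ 3)
lemma6 R a (suc (suc (suc (suc k)))) (s≤s (s≤s (s≤s (s≤s z≤n)))) = begin
  Pdet (4 ℕ.+ k) a
    ≈⟨ P-expand k a ⟩
  (C₃ - Gdet 1 (3 ℕ.+ k)) + s * (a * Hdet 2 3 (3 ℕ.+ k))
    ≈⟨ +-cong (+-congˡ (-‿cong (G₁≈C-C (suc k)))) (*-congˡ (*-congˡ (proj₁ (H≈C (suc k))))) ⟩
  (C₃ - (C₂ - C₁)) + s * (a * C₃)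
    ≈⟨ rearrange a C₃ C₂ C₁ s ⟩
  (C₃ * (1# + a * s) - C₂) + C₁
    ≈⟨ +-congʳ (+-congʳ (*-congˡ (+-congˡ (*-congˡ sign-shift)))) ⟩
  (C₃ * (1# + a * sign (4 ℕ.+ k ℕ.+ 1)) - C₂) + C₁
    ∎
  where
  open CommutativeRing R
  open Determinant R
  open BandDeterminants R
  open import Relation.Binary.Reasoning.Setoid setoid
  C₃ C₂ C₁ s : Carrier
  C₃ = Cdet (3 ℕ.+ k)
  C₂ = Cdet (2 ℕ.+ k)
  C₁ = Cdet (1 ℕ.+ k)
  s  = sign (3 ℕ.+ k)
  sign-shift : s ≈ sign (4 ℕ.+ k ℕ.+ 1)
  sign-shift = trans (sym (sign-+2 (3 ℕ.+ k))) (reflexive (≡.cong (λ t → sign (4 ℕ.+ t)) (ℕP.+-comm 1 k)))
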